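{- Let $t\ge1$ and let $a_1,\dots,a_t,a'_1,\dots,a'_t,b_1,\dots,b_t,b'_1,\dots,b'_t$ be independent variables. Then in the field of rational functions in these variables over $\mathbb Q$, $$\prod_{i=1}^ta_ib_i-\prod_{i=1}^ta'_ib'_i=\sum_{i=1}^t\left(\prod_{j=1}^t(a_ib_j-a'_ib'_j)\right)\left(\prod_{1\le j\le t,\ j\neq i}\left(\frac{a_i}{a_j}-\frac{a'_i}{a'_j}\right)^{ -1}\right).$$ -}

module Defs where

open import Data.Nat using (ℕ; zero; suc)
open import Data.Fin using (Fin; zero; suc; _≟_)
open import Data.Rational using (ℚ; 0ℚ; 1ℚ; _*_; _+_; _-_; _÷_; 1/_; ≢-nonZero)
open import Relation.Binary.PropositionalEquality using (_≡_; _≢_)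
open import Relation.Nullary using (yes; no)

prod : ∀ {n} → (Fin n → ℚ) → ℚ
prod {zero}  f = 1ℚ
prod {suc n} f = f zero * prod (λ i → f (suc i))

sum : ∀ {n} → (Fin n → ℚ) → ℚ
sum {zero}  f = 0ℚ
sum {suc n} f = f zero + sum (λ i → f (suc i))

ratio : ∀ {t} (a : Fin t → ℚ) → (∀ j → a j ≢ 0ℚ) → Fin t → Fin t → ℚ
ratio a ha i j = _÷_ (a i) (a j) {{≢-nonZero (ha j)}}

diff : ∀ {t} (a a' : Fin t → ℚ) → (∀ j → a j ≢ 0ℚ) → (∀ j → a' j ≢ 0ℚ) →
       Fin t → Fin t → ℚ
diff a a' ha ha' i j = ratio a ha i j - ratio a' ha' i j

-- the j-th factor of ∏_{j ≠ i} (a_i/a_j − a'_i/a'_j)^{-1}; the factor j = i is 1,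
-- so the product over all j of these factors is the product over j ≠ i.
invFactor : ∀ {t} (a a' : Fin t → ℚ) (ha : ∀ j → a j ≢ 0ℚ) (ha' : ∀ j → a' j ≢ 0ℚ) →
            (∀ i j → i ≢ j → diff a a' ha ha' i j ≢ 0ℚ) →
            Fin t → Fin t → ℚ
invFactor a a' ha ha' hd i j with i ≟ j
... | yes _  = 1ℚ
... | no i≢j = 1/_ (diff a a' ha ha' i j) {{≢-nonZero (hd i j i≢j)}}

{-# OPTIONS --safe #-}
module Submission where

-- Put xᵢ = aᵢ/a′ᵢ. Then aᵢbⱼ − a′ᵢb′ⱼ = a′ᵢ(bⱼxᵢ − b′ⱼ) and aᵢ/aⱼ − a′ᵢ/a′ⱼ = (a′ᵢ/aⱼ)(xᵢ − xⱼ),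
-- so, divided by ∏ⱼ aⱼ, the i-th summand is P(xᵢ) / (xᵢ ∏_{j≠i} (xᵢ − xⱼ)) for the polynomial
-- P(y) = ∏ⱼ (bⱼy − b′ⱼ) of degree t. Adding the term P(0) / ∏ⱼ (0 − xⱼ) = ∏ⱼ a′ⱼb′ⱼ / ∏ⱼ aⱼ
-- gives the divided difference of P at the t + 1 distinct nodes 0, x₁, …, x_t, which is the
-- leading coefficient ∏ⱼ bⱼ of P. That divided differences on n nodes return the leading
-- coefficient of polynomials of degree n − 1 and kill those of lower degree follows by
-- splitting off one linear factor at a time: multiplying the values by (y − x_k) turns a
-- divided difference on n nodes into one on the n − 1 nodes other than x_k.

open import Defs
open import Algebra.Properties.Group using (x∙y⁻¹≈ε⇒x≈y)
open import Data.Fin using (Fin; zero; suc; _≟_)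
open import Data.Fin.Patterns using (0F; 1F)
open import Data.Fin.Properties using (suc-injective; punchIn-injective; punchInᵢ≢i; 0≢1+n)
open import Data.Nat using (ℕ; zero; suc; _≤_; s≤s)
open import Data.Nat.Properties using (m≤n⇒m≤1+n; ≤-refl)
open import Data.Rational using (ℚ; 0ℚ; 1ℚ; _+_; _*_; _-_; -_; 1/_; NonZero; ≢-nonZero)
open import Data.Rational.Properties
  using ( +-0-group; +-identityˡ; +-identityʳ; +-*-commutativeRing; *-assoc; *-identityˡ
        ; *-identityʳ; *-zeroˡ; *-zeroʳ; *-distribˡ-+; *-inverseˡ; *-inverseʳ)
  renaming (_≟_ to _≟ℚ_)
open import Data.Vec.Functional using (Vector; head; tail; removeAt; _∷_)
open import Function using (_∘_)
open import Function.Definitions using (Injective)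
open import Level using (0ℓ)
open import Relation.Binary.PropositionalEquality
open import Relation.Nullary using (yes; no)
open import Relation.Nullary.Decidable.Core using (dec⇒maybe)
open import Relation.Nullary.Negation using (contradiction)
open import Tactic.RingSolver using (solve-∀)
open import Tactic.RingSolver.Core.AlmostCommutativeRing
  using (AlmostCommutativeRing; fromCommutativeRing)

open ≡-Reasoning

ℚ-ring : AlmostCommutativeRing 0ℓ 0ℓ
ℚ-ring = fromCommutativeRing +-*-commutativeRing (dec⇒maybe ∘ (0ℚ ≟ℚ_))

p≢q⇒p-q≢0 : ∀ {p q} → p ≢ q → p - q ≢ 0ℚ
p≢q⇒p-q≢0 {p} {q} p≢q = p≢q ∘ x∙y⁻¹≈ε⇒x≈y +-0-group p q

-- A total inverse with junk value inv 0ℚ = 0ℚ, so that divided differences need no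
-- nonzeroness proofs.
inv : ℚ → ℚ
inv p with p ≟ℚ 0ℚ
... | yes _   = 0ℚ
... | no p≢0 = 1/_ p {{≢-nonZero p≢0}}

inv-inverseʳ : ∀ {p} → p ≢ 0ℚ → p * inv p ≡ 1ℚ
inv-inverseʳ {p} p≢0 with p ≟ℚ 0ℚ
... | yes p≡0 = contradiction p≡0 p≢0
... | no p≢0′ = *-inverseʳ p {{≢-nonZero p≢0′}}

1/-unique : ∀ p .{{_ : NonZero p}} {q} → p * q ≡ 1ℚ → 1/ p ≡ q
1/-unique p {q} pq≡1 = begin
  1/ p              ≡⟨ sym (*-identityʳ (1/ p)) ⟩
  1/ p * 1ℚ         ≡⟨ cong (1/ p *_) (sym pq≡1) ⟩
  1/ p * (p * q)    ≡⟨ sym (*-assoc (1/ p) p q) ⟩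
  (1/ p * p) * q    ≡⟨ cong (_* q) (*-inverseˡ p) ⟩
  1ℚ * q            ≡⟨ *-identityˡ q ⟩
  q                 ∎

inv-unique : ∀ {p q} → p * q ≡ 1ℚ → inv p ≡ q
inv-unique {p} {q} pq≡1 with p ≟ℚ 0ℚ
... | yes refl = contradiction (trans (sym (*-zeroˡ q)) pq≡1) λ ()
... | no p≢0  = 1/-unique p {{≢-nonZero p≢0}} pq≡1

inv≡1/ : ∀ {p} (p≢0 : p ≢ 0ℚ) → inv p ≡ 1/_ p {{≢-nonZero p≢0}}
inv≡1/ {p} p≢0 = inv-unique {p} (*-inverseʳ p {{≢-nonZero p≢0}})

prod-cong : ∀ {n} {f g : Vector ℚ n} → (∀ i → f i ≡ g i) → prod f ≡ prod g
prod-cong {zero}  f≗g = refl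
prod-cong {suc n} f≗g = cong₂ _*_ (f≗g zero) (prod-cong (f≗g ∘ suc))

sum-cong : ∀ {n} {f g : Vector ℚ n} → (∀ i → f i ≡ g i) → sum f ≡ sum g
sum-cong {zero}  f≗g = refl
sum-cong {suc n} f≗g = cong₂ _+_ (f≗g zero) (sum-cong (f≗g ∘ suc))

prod-* : ∀ {n} (f g : Vector ℚ n) → prod (λ i → f i * g i) ≡ prod f * prod g
prod-* {zero}  f g = sym (*-identityˡ 1ℚ)
prod-* {suc n} f g = begin
  (f zero * g zero) * prod (λ i → tail f i * tail g i)
    ≡⟨ cong ((f zero * g zero) *_) (prod-* (tail f) (tail g)) ⟩
  (f zero * g zero) * (prod (tail f) * prod (tail g))
    ≡⟨ interchange (f zero) (g zero) (prod (tail f)) (prod (tail g)) ⟩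
  (f zero * prod (tail f)) * (g zero * prod (tail g)) ∎
  where
  interchange : ∀ p q r s → (p * q) * (r * s) ≡ (p * r) * (q * s)
  interchange = solve-∀ ℚ-ring

*-distribˡ-sum : ∀ {n} c (f : Vector ℚ n) → c * sum f ≡ sum (λ i → c * f i)
*-distribˡ-sum {zero}  c f = *-zeroʳ c
*-distribˡ-sum {suc n} c f =
  trans (*-distribˡ-+ c (f zero) (sum (tail f))) (cong (c * f zero +_) (*-distribˡ-sum c (tail f)))

prod-removeAt : ∀ {n} (f : Vector ℚ (suc n)) k → prod f ≡ f k * prod (removeAt f k)
prod-removeAt         f zero    = refl
prod-removeAt {suc n} f (suc k) = begin
  f zero * prod (tail f)                            ≡⟨ cong (f zero *_) (prod-removeAt (tail f) k) ⟩
  f zero * (f (suc k) * prod (removeAt (tail f) k)) ≡⟨ left-comm (f zero) (f (suc k)) _ ⟩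
  f (suc k) * (f zero * prod (removeAt (tail f) k)) ∎
  where
  left-comm : ∀ p q r → p * (q * r) ≡ q * (p * r)
  left-comm = solve-∀ ℚ-ring

prod-scale-at : ∀ {n} {f g : Vector ℚ n} k {c} →
                (∀ j → j ≢ k → f j ≡ g j) → f k ≡ g k * c → prod f ≡ prod g * c
prod-scale-at {suc n} {f} {g} k {c} f≡g fₖ≡gₖc = begin
  prod f                          ≡⟨ prod-removeAt f k ⟩
  f k * prod (removeAt f k)       ≡⟨ cong₂ _*_ fₖ≡gₖc (prod-cong λ j → f≡g _ (punchInᵢ≢i k j)) ⟩
  g k * c * prod (removeAt g k)   ≡⟨ right-comm (g k) c _ ⟩
  g k * prod (removeAt g k) * c   ≡⟨ cong (_* c) (sym (prod-removeAt g k)) ⟩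
  prod g * c                      ∎
  where
  right-comm : ∀ p q r → p * q * r ≡ p * r * q
  right-comm = solve-∀ ℚ-ring

-- The divided difference of the values v at the nodes x; divDiff≡sum gives the closed form
-- Σᵢ vᵢ ∏_{j ≠ i} (xᵢ − xⱼ)⁻¹.
divDiff : ∀ {n} → Vector ℚ n → Vector ℚ n → ℚ
divDiff {zero}  x v = 0ℚ
divDiff {suc n} x v = head v * prod (λ j → inv (head x - tail x j))
                    + divDiff (tail x) (λ i → tail v i * inv (tail x i - head x))

divDiff-congʳ : ∀ {n} (x : Vector ℚ n) {v u} → (∀ i → v i ≡ u i) → divDiff x v ≡ divDiff x u
divDiff-congʳ {zero}  x v≗u = refl
divDiff-congʳ {suc n} x v≗u =
  cong₂ _+_ (cong (_* _) (v≗u zero)) (divDiff-congʳ (tail x) (cong (_* _) ∘ v≗u ∘ suc))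

divDiff-linear : ∀ {n} (x v u : Vector ℚ n) c d →
                 divDiff x (λ i → c * v i + d * u i) ≡ c * divDiff x v + d * divDiff x u
divDiff-linear {zero}  x v u c d = zeros c d
  where
  zeros : ∀ c d → 0ℚ ≡ c * 0ℚ + d * 0ℚ
  zeros = solve-∀ ℚ-ring
divDiff-linear {suc n} x v u c d = begin
  (c * v₀ + d * u₀) * W + divDiff (tail x) (λ i → (c * tail v i + d * tail u i) * I i)
    ≡⟨ cong (H +_) (divDiff-congʳ (tail x) λ i → distrib c d (tail v i) (tail u i) (I i)) ⟩
  (c * v₀ + d * u₀) * W + divDiff (tail x) (λ i → c * (tail v i * I i) + d * (tail u i * I i))
    ≡⟨ cong (H +_) (divDiff-linear (tail x) v′ u′ c d) ⟩
  (c * v₀ + d * u₀) * W + (c * divDiff (tail x) v′ + d * divDiff (tail x) u′)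
    ≡⟨ regroup c d v₀ u₀ W _ _ ⟩
  c * (v₀ * W + divDiff (tail x) v′) + d * (u₀ * W + divDiff (tail x) u′) ∎
  where
  v₀ u₀ W H : ℚ
  v₀ = head v
  u₀ = head u
  W = prod (λ j → inv (head x - tail x j))
  H = (c * v₀ + d * u₀) * W
  I v′ u′ : Vector ℚ n
  I i = inv (tail x i - head x)
  v′ i = tail v i * I i
  u′ i = tail u i * I i
  distrib : ∀ c d p q r → (c * p + d * q) * r ≡ c * (p * r) + d * (q * r)
  distrib = solve-∀ ℚ-ring
  regroup : ∀ c d p q w A B →
            (c * p + d * q) * w + (c * A + d * B) ≡ c * (p * w + A) + d * (q * w + B)
  regroup = solve-∀ ℚ-ring

p*q*inv[p]≡q : ∀ {p} q → p ≢ 0ℚ → p * q * inv p ≡ q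
p*q*inv[p]≡q {p} q p≢0 = begin
  p * q * inv p     ≡⟨ right-comm p q (inv p) ⟩
  p * inv p * q     ≡⟨ cong (_* q) (inv-inverseʳ p≢0) ⟩
  1ℚ * q            ≡⟨ *-identityˡ q ⟩
  q                 ∎
  where
  right-comm : ∀ p q r → p * q * r ≡ p * r * q
  right-comm = solve-∀ ℚ-ring

c*[p-p]≡0 : ∀ c p → c * (p - p) ≡ 0ℚ
c*[p-p]≡0 = solve-∀ ℚ-ring

tail-injective : ∀ {n} {x : Vector ℚ (suc n)} → Injective _≡_ _≡_ x → Injective _≡_ _≡_ (tail x)
tail-injective x-inj = suc-injective ∘ x-inj

removeAt-injective : ∀ {n} {x : Vector ℚ (suc n)} k →
                     Injective _≡_ _≡_ x → Injective _≡_ _≡_ (removeAt x k)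
removeAt-injective k x-inj = punchIn-injective k _ _ ∘ x-inj

divDiff-removeAt : ∀ {n} (x : Vector ℚ (suc n)) → Injective _≡_ _≡_ x → ∀ k w →
                   divDiff x (λ i → (x i - x k) * w i) ≡ divDiff (removeAt x k) (removeAt w k)
divDiff-removeAt {n} x x-inj zero w = begin
  (head x - head x) * head w * W + divDiff (tail x) (λ i → (tail x i - head x) * tail w i * I i)
    ≡⟨ cong₂ _+_ (x-x≡0 (head x) (head w) W) (divDiff-congʳ (tail x) cancel) ⟩
  0ℚ + divDiff (tail x) (tail w)
    ≡⟨ +-identityˡ _ ⟩
  divDiff (tail x) (tail w) ∎
  where
  W : ℚ
  W = prod (λ j → inv (head x - tail x j))
  I : Vector ℚ n
  I i = inv (tail x i - head x)
  x-x≡0 : ∀ p q r → (p - p) * q * r ≡ 0ℚ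
  x-x≡0 = solve-∀ ℚ-ring
  cancel : ∀ i → (tail x i - head x) * tail w i * I i ≡ tail w i
  cancel i = p*q*inv[p]≡q (tail w i) (p≢q⇒p-q≢0 λ xᵢ≡x₀ → 0≢1+n (sym (x-inj xᵢ≡x₀)))
divDiff-removeAt {suc n} x x-inj (suc k) w = cong₂ _+_ head-term tail-term
  where
  W′ d : ℚ
  W′ = prod (λ j → inv (head x - removeAt (tail x) k j))
  d = head x - tail x k
  I : Vector ℚ (suc n)
  I i = inv (tail x i - head x)
  head-term : d * head w * prod (λ j → inv (head x - tail x j)) ≡ head w * W′
  head-term = begin
    d * head w * prod (λ j → inv (head x - tail x j))
      ≡⟨ cong (d * head w *_) (prod-removeAt (λ j → inv (head x - tail x j)) k) ⟩
    d * head w * (inv d * W′)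
      ≡⟨ regroup d (head w) (inv d) W′ ⟩
    d * (head w * W′) * inv d
      ≡⟨ p*q*inv[p]≡q (head w * W′) (p≢q⇒p-q≢0 λ x₀≡xₖ → 0≢1+n (x-inj x₀≡xₖ)) ⟩
    head w * W′ ∎
    where
    regroup : ∀ p q r s → p * q * (r * s) ≡ p * (q * s) * r
    regroup = solve-∀ ℚ-ring
  tail-term : divDiff (tail x) (λ i → (tail x i - tail x k) * tail w i * I i)
            ≡ divDiff (removeAt (tail x) k) (removeAt (λ i → tail w i * I i) k)
  tail-term = begin
    divDiff (tail x) (λ i → (tail x i - tail x k) * tail w i * I i)
      ≡⟨ divDiff-congʳ (tail x) (λ i → *-assoc (tail x i - tail x k) (tail w i) (I i)) ⟩
    divDiff (tail x) (λ i → (tail x i - tail x k) * (tail w i * I i))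
      ≡⟨ divDiff-removeAt (tail x) (tail-injective x-inj) k (λ i → tail w i * I i) ⟩
    divDiff (removeAt (tail x) k) (removeAt (λ i → tail w i * I i) k) ∎

divDiff-one-split : ∀ {n} (x : Vector ℚ (suc (suc n))) → Injective _≡_ _≡_ x →
  divDiff x (λ _ → 1ℚ)
    ≡ inv (x 1F - x 0F) * (divDiff (removeAt x 0F) (λ _ → 1ℚ) - divDiff (removeAt x 1F) (λ _ → 1ℚ))
divDiff-one-split {n} x x-inj = begin
  divDiff x (λ _ → 1ℚ)
    ≡⟨ divDiff-congʳ x one≡ ⟩
  divDiff x (λ i → c * ((x i - x 0F) * 1ℚ) + (- c) * ((x i - x 1F) * 1ℚ))
    ≡⟨ divDiff-linear x (λ i → (x i - x 0F) * 1ℚ) (λ i → (x i - x 1F) * 1ℚ) c (- c) ⟩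
  c * divDiff x (λ i → (x i - x 0F) * 1ℚ) + (- c) * divDiff x (λ i → (x i - x 1F) * 1ℚ)
    ≡⟨ cong₂ (λ p q → c * p + (- c) * q)
             (divDiff-removeAt x x-inj 0F one) (divDiff-removeAt x x-inj 1F one) ⟩
  c * divDiff (removeAt x 0F) (λ _ → 1ℚ) + (- c) * divDiff (removeAt x 1F) (λ _ → 1ℚ)
    ≡⟨ factor c (divDiff (removeAt x 0F) (λ _ → 1ℚ)) (divDiff (removeAt x 1F) (λ _ → 1ℚ)) ⟩
  c * (divDiff (removeAt x 0F) (λ _ → 1ℚ) - divDiff (removeAt x 1F) (λ _ → 1ℚ)) ∎
  where
  c : ℚ
  c = inv (x 1F - x 0F)
  one : Vector ℚ (suc (suc n))
  one _ = 1ℚ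
  two-nodes : ∀ c y p q → c * ((y - p) * 1ℚ) + (- c) * ((y - q) * 1ℚ) ≡ (q - p) * c
  two-nodes = solve-∀ ℚ-ring
  factor : ∀ c p q → c * p + (- c) * q ≡ c * (p - q)
  factor = solve-∀ ℚ-ring
  one≡ : ∀ i → 1ℚ ≡ c * ((x i - x 0F) * 1ℚ) + (- c) * ((x i - x 1F) * 1ℚ)
  one≡ i = sym (trans (two-nodes c (x i) (x 0F) (x 1F))
                      (inv-inverseʳ (p≢q⇒p-q≢0 λ x₁≡x₀ → 0≢1+n (sym (x-inj x₁≡x₀)))))

divDiff-one-vanishes : ∀ {n} (x : Vector ℚ (suc (suc n))) → Injective _≡_ _≡_ x →
                       divDiff x (λ _ → 1ℚ) ≡ 0ℚ
-- On a single node, divDiff of the constant 1 is the closed term 1ℚ * 1ℚ + 0ℚ.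
divDiff-one-vanishes {zero} x x-inj =
  trans (divDiff-one-split x x-inj) (c*[p-p]≡0 (inv (x 1F - x 0F)) (1ℚ * 1ℚ + 0ℚ))
divDiff-one-vanishes {suc n} x x-inj = begin
  divDiff x (λ _ → 1ℚ)
    ≡⟨ divDiff-one-split x x-inj ⟩
  c * (divDiff (removeAt x 0F) (λ _ → 1ℚ) - divDiff (removeAt x 1F) (λ _ → 1ℚ))
    ≡⟨ cong₂ (λ p q → c * (p - q)) (vanishes-without 0F) (vanishes-without 1F) ⟩
  c * (0ℚ - 0ℚ)
    ≡⟨ c*[p-p]≡0 c 0ℚ ⟩
  0ℚ ∎
  where
  c : ℚ
  c = inv (x 1F - x 0F)
  vanishes-without : ∀ k → divDiff (removeAt x k) (λ _ → 1ℚ) ≡ 0ℚ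
  vanishes-without k = divDiff-one-vanishes (removeAt x k) (removeAt-injective k x-inj)

linearProduct : ∀ {m} → Vector ℚ m → Vector ℚ m → ℚ → ℚ
linearProduct b c y = prod (λ k → b k * y - c k)

divDiff-linearProduct-split : ∀ {m n} (x : Vector ℚ (suc n)) → Injective _≡_ _≡_ x →
  (b c : Vector ℚ (suc m)) →
  divDiff x (linearProduct b c ∘ x)
    ≡ head b * divDiff (tail x) (linearProduct (tail b) (tail c) ∘ tail x)
      + (head b * head x - head c) * divDiff x (linearProduct (tail b) (tail c) ∘ x)
divDiff-linearProduct-split x x-inj b c = begin
  divDiff x (linearProduct b c ∘ x)
    ≡⟨ divDiff-congʳ x (λ i → expand (head b) (head c) (x i) (head x) (Q (x i))) ⟩
  divDiff x (λ i → head b * ((x i - head x) * Q (x i)) + e * Q (x i))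
    ≡⟨ divDiff-linear x (λ i → (x i - head x) * Q (x i)) (Q ∘ x) (head b) e ⟩
  head b * divDiff x (λ i → (x i - head x) * Q (x i)) + e * divDiff x (Q ∘ x)
    ≡⟨ cong (λ p → head b * p + e * divDiff x (Q ∘ x)) (divDiff-removeAt x x-inj 0F (Q ∘ x)) ⟩
  head b * divDiff (tail x) (Q ∘ tail x) + e * divDiff x (Q ∘ x) ∎
  where
  Q : ℚ → ℚ
  Q = linearProduct (tail b) (tail c)
  e : ℚ
  e = head b * head x - head c
  expand : ∀ b₀ c₀ y x₀ q → (b₀ * y - c₀) * q ≡ b₀ * ((y - x₀) * q) + (b₀ * x₀ - c₀) * q
  expand = solve-∀ ℚ-ring

divDiff-linearProduct-vanishes : ∀ m {n} (x : Vector ℚ n) → Injective _≡_ _≡_ x → suc (suc m) ≤ n →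
  (b c : Vector ℚ m) → divDiff x (linearProduct b c ∘ x) ≡ 0ℚ
divDiff-linearProduct-vanishes zero    x x-inj (s≤s (s≤s _)) b c = divDiff-one-vanishes x x-inj
divDiff-linearProduct-vanishes (suc m) x x-inj (s≤s m+2≤n)  b c = begin
  divDiff x (linearProduct b c ∘ x)
    ≡⟨ divDiff-linearProduct-split x x-inj b c ⟩
  head b * divDiff (tail x) (Q ∘ tail x) + e * divDiff x (Q ∘ x)
    ≡⟨ cong₂ (λ p q → head b * p + e * q)
         (divDiff-linearProduct-vanishes m (tail x) (tail-injective x-inj) m+2≤n (tail b) (tail c))
         (divDiff-linearProduct-vanishes m x x-inj (m≤n⇒m≤1+n m+2≤n) (tail b) (tail c)) ⟩
  head b * 0ℚ + e * 0ℚ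
    ≡⟨ zeros (head b) e ⟩
  0ℚ ∎
  where
  Q : ℚ → ℚ
  Q = linearProduct (tail b) (tail c)
  e : ℚ
  e = head b * head x - head c
  zeros : ∀ p q → p * 0ℚ + q * 0ℚ ≡ 0ℚ
  zeros = solve-∀ ℚ-ring

divDiff-linearProduct-leading : ∀ {m} (x : Vector ℚ (suc m)) → Injective _≡_ _≡_ x →
  (b c : Vector ℚ m) → divDiff x (linearProduct b c ∘ x) ≡ prod b
divDiff-linearProduct-leading {zero}  x x-inj b c = refl
divDiff-linearProduct-leading {suc m} x x-inj b c = begin
  divDiff x (linearProduct b c ∘ x)
    ≡⟨ divDiff-linearProduct-split x x-inj b c ⟩
  head b * divDiff (tail x) (Q ∘ tail x) + e * divDiff x (Q ∘ x)
    ≡⟨ cong₂ (λ p q → head b * p + e * q)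
         (divDiff-linearProduct-leading (tail x) (tail-injective x-inj) (tail b) (tail c))
         (divDiff-linearProduct-vanishes m x x-inj ≤-refl (tail b) (tail c)) ⟩
  head b * prod (tail b) + e * 0ℚ
    ≡⟨ drop-zero (head b * prod (tail b)) e ⟩
  prod b ∎
  where
  Q : ℚ → ℚ
  Q = linearProduct (tail b) (tail c)
  e : ℚ
  e = head b * head x - head c
  drop-zero : ∀ p q → p + q * 0ℚ ≡ p
  drop-zero = solve-∀ ℚ-ring

-- invDiff x i j is (xᵢ − xⱼ)⁻¹ off the diagonal and 1 on it, like invFactor, but is defined
-- by recursion so that it unfolds along with divDiff.
invDiff : ∀ {n} → Vector ℚ n → Fin n → Fin n → ℚ
invDiff x zero    zero    = 1ℚ
invDiff x zero    (suc j) = inv (head x - tail x j)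
invDiff x (suc i) zero    = inv (tail x i - head x)
invDiff x (suc i) (suc j) = invDiff (tail x) i j

invDiff-diag : ∀ {n} (x : Vector ℚ n) i → invDiff x i i ≡ 1ℚ
invDiff-diag x zero    = refl
invDiff-diag x (suc i) = invDiff-diag (tail x) i

invDiff-off : ∀ {n} (x : Vector ℚ n) {i j} → i ≢ j → invDiff x i j ≡ inv (x i - x j)
invDiff-off x {zero}  {zero}  i≢j = contradiction refl i≢j
invDiff-off x {zero}  {suc j} i≢j = refl
invDiff-off x {suc i} {zero}  i≢j = refl
invDiff-off x {suc i} {suc j} i≢j = invDiff-off (tail x) (i≢j ∘ cong suc)

divDiff≡sum : ∀ {n} (x v : Vector ℚ n) → divDiff x v ≡ sum (λ i → v i * prod (invDiff x i))
divDiff≡sum {zero}  x v = refl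
divDiff≡sum {suc n} x v = cong₂ _+_
  (cong (head v *_) (sym (*-identityˡ _)))
  (trans (divDiff≡sum (tail x) (λ i → tail v i * inv (tail x i - head x)))
         (sum-cong λ i → *-assoc (tail v i) _ _))

module _ {t} (a a' b b' : Vector ℚ t) (ha : ∀ j → a j ≢ 0ℚ) (ha' : ∀ j → a' j ≢ 0ℚ)
         (hd : ∀ i j → i ≢ j → diff a a' ha ha' i j ≢ 0ℚ) where

  x : Vector ℚ t
  x i = a i * inv (a' i)

  x*a′≡a : ∀ i → x i * a' i ≡ a i
  x*a′≡a i = begin
    a i * inv (a' i) * a' i    ≡⟨ right-comm (a i) (inv (a' i)) (a' i) ⟩
    a i * (a' i * inv (a' i))  ≡⟨ cong (a i *_) (inv-inverseʳ (ha' i)) ⟩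
    a i * 1ℚ                   ≡⟨ *-identityʳ (a i) ⟩
    a i                        ∎
    where
    right-comm : ∀ p q r → p * q * r ≡ p * (r * q)
    right-comm = solve-∀ ℚ-ring

  x≢0 : ∀ i → x i ≢ 0ℚ
  x≢0 i xᵢ≡0 = ha i (begin
    a i           ≡⟨ sym (x*a′≡a i) ⟩
    x i * a' i    ≡⟨ cong (_* a' i) xᵢ≡0 ⟩
    0ℚ * a' i     ≡⟨ *-zeroˡ (a' i) ⟩
    0ℚ            ∎)

  diff≡ : ∀ i j → diff a a' ha ha' i j ≡ a' i * inv (a j) * (x i - x j)
  diff≡ i j = begin
    diff a a' ha ha' i j
      ≡⟨ cong₂ (λ p q → a i * p - a' i * q) (sym (inv≡1/ (ha j))) (sym (inv≡1/ (ha' j))) ⟩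
    a i * inv (a j) - a' i * inv (a' j)
      ≡⟨ sym (times-one (a i * inv (a j)) (a' i * inv (a' j))) ⟩
    a i * inv (a j) * 1ℚ - a' i * inv (a' j) * 1ℚ
      ≡⟨ sym (cong₂ (λ p q → a i * inv (a j) * p - a' i * inv (a' j) * q)
                    (inv-inverseʳ (ha' i)) (inv-inverseʳ (ha j))) ⟩
    a i * inv (a j) * (a' i * inv (a' i)) - a' i * inv (a' j) * (a j * inv (a j))
      ≡⟨ sym (expand (a i) (a j) (a' i) (inv (a j)) (inv (a' i)) (inv (a' j))) ⟩
    a' i * inv (a j) * (x i - x j) ∎
    where
    times-one : ∀ p q → p * 1ℚ - q * 1ℚ ≡ p - q
    times-one = solve-∀ ℚ-ring
    expand : ∀ aᵢ aⱼ a′ᵢ iaⱼ ia′ᵢ ia′ⱼ →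
             a′ᵢ * iaⱼ * (aᵢ * ia′ᵢ - aⱼ * ia′ⱼ) ≡ aᵢ * iaⱼ * (a′ᵢ * ia′ᵢ) - a′ᵢ * ia′ⱼ * (aⱼ * iaⱼ)
    expand = solve-∀ ℚ-ring

  x-injective : Injective _≡_ _≡_ x
  x-injective {i} {j} xᵢ≡xⱼ with i ≟ j
  ... | yes i≡j = i≡j
  ... | no i≢j = contradiction (begin
    diff a a' ha ha' i j             ≡⟨ diff≡ i j ⟩
    a' i * inv (a j) * (x i - x j)   ≡⟨ cong (λ z → a' i * inv (a j) * (x i - z)) (sym xᵢ≡xⱼ) ⟩
    a' i * inv (a j) * (x i - x i)   ≡⟨ c*[p-p]≡0 (a' i * inv (a j)) (x i) ⟩
    0ℚ                               ∎) (hd i j i≢j)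

  nodes : Vector ℚ (suc t)
  nodes = 0ℚ ∷ x

  nodes-injective : Injective _≡_ _≡_ nodes
  nodes-injective {zero}  {zero}  _      = refl
  nodes-injective {zero}  {suc j} 0≡xⱼ   = contradiction (sym 0≡xⱼ) (x≢0 j)
  nodes-injective {suc i} {zero}  xᵢ≡0   = contradiction xᵢ≡0 (x≢0 i)
  nodes-injective {suc i} {suc j} xᵢ≡xⱼ = cong suc (x-injective xᵢ≡xⱼ)

  a*b-a′*b′≡a′*[b*x-b′] : ∀ i j → a i * b j - a' i * b' j ≡ a' i * (b j * x i - b' j)
  a*b-a′*b′≡a′*[b*x-b′] i j = begin
    a i * b j - a' i * b' j            ≡⟨ cong (λ z → z * b j - a' i * b' j) (sym (x*a′≡a i)) ⟩
    x i * a' i * b j - a' i * b' j     ≡⟨ regroup (x i) (a' i) (b j) (b' j) ⟩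
    a' i * (b j * x i - b' j)          ∎
    where
    regroup : ∀ p q r s → p * q * r - q * s ≡ q * (r * p - s)
    regroup = solve-∀ ℚ-ring

  invFactor-diag : ∀ i → invFactor a a' ha ha' hd i i ≡ 1ℚ
  invFactor-diag i with i ≟ i
  ... | yes _   = refl
  ... | no i≢i = contradiction refl i≢i

  invFactor-off : ∀ i j → j ≢ i → invFactor a a' ha ha' hd i j ≡ a j * inv (a' i) * inv (x i - x j)
  invFactor-off i j j≢i with i ≟ j
  ... | yes i≡j = contradiction (sym i≡j) j≢i
  ... | no i≢j = 1/-unique (diff a a' ha ha' i j) {{≢-nonZero (hd i j i≢j)}} (begin
    diff a a' ha ha' i j * (a j * inv (a' i) * inv d)
      ≡⟨ cong (_* (a j * inv (a' i) * inv d)) (diff≡ i j) ⟩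
    a' i * inv (a j) * d * (a j * inv (a' i) * inv d)
      ≡⟨ regroup (a' i) (inv (a' i)) (a j) (inv (a j)) d (inv d) ⟩
    (a' i * inv (a' i)) * ((a j * inv (a j)) * (d * inv d))
      ≡⟨ cong₂ _*_ (inv-inverseʳ (ha' i))
           (cong₂ _*_ (inv-inverseʳ (ha j)) (inv-inverseʳ (p≢q⇒p-q≢0 (i≢j ∘ x-injective)))) ⟩
    1ℚ * (1ℚ * 1ℚ)
      ≡⟨⟩
    1ℚ ∎)
    where
    d : ℚ
    d = x i - x j
    regroup : ∀ p ip q iq r ir → p * iq * r * (q * ip * ir) ≡ (p * ip) * ((q * iq) * (r * ir))
    regroup = solve-∀ ℚ-ring

  inv[x]≡a′*inv[a] : ∀ i → inv (x i) ≡ a' i * inv (a i)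
  inv[x]≡a′*inv[a] i = inv-unique {x i} (begin
    x i * (a' i * inv (a i))   ≡⟨ sym (*-assoc (x i) (a' i) (inv (a i))) ⟩
    x i * a' i * inv (a i)     ≡⟨ cong (_* inv (a i)) (x*a′≡a i) ⟩
    a i * inv (a i)            ≡⟨ inv-inverseʳ (ha i) ⟩
    1ℚ                         ∎)

  inv[0-x]≡-a′*inv[a] : ∀ i → inv (0ℚ - x i) ≡ - (a' i * inv (a i))
  inv[0-x]≡-a′*inv[a] i = inv-unique {0ℚ - x i} (begin
    (0ℚ - x i) * - (a' i * inv (a i))   ≡⟨ negate (x i) (a' i) (inv (a i)) ⟩
    x i * a' i * inv (a i)              ≡⟨ cong (_* inv (a i)) (x*a′≡a i) ⟩
    a i * inv (a i)                     ≡⟨ inv-inverseʳ (ha i) ⟩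
    1ℚ                                  ∎)
    where
    negate : ∀ p q r → (0ℚ - p) * - (q * r) ≡ p * q * r
    negate = solve-∀ ℚ-ring

  summand≡ : ∀ i → prod (λ j → a i * b j - a' i * b' j) * prod (invFactor a a' ha ha' hd i)
              ≡ prod a * (linearProduct b b' (x i) * inv (x i - 0ℚ) * prod (invDiff x i))
  summand≡ i = begin
    prod (λ j → a i * b j - a' i * b' j) * prod (invFactor a a' ha ha' hd i)
      ≡⟨ sym (prod-* (λ j → a i * b j - a' i * b' j) (invFactor a a' ha ha' hd i)) ⟩
    prod g
      ≡⟨ prod-scale-at i g≡h gᵢ≡hᵢ*inv[xᵢ] ⟩
    prod (λ j → a j * B j * invDiff x i j) * inv (x i)
      ≡⟨ cong (_* inv (x i)) (prod-* (λ j → a j * B j) (invDiff x i)) ⟩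
    prod (λ j → a j * B j) * prod (invDiff x i) * inv (x i)
      ≡⟨ cong (λ p → p * prod (invDiff x i) * inv (x i)) (prod-* a B) ⟩
    prod a * prod B * prod (invDiff x i) * inv (x i)
      ≡⟨ regroup (prod a) (prod B) (prod (invDiff x i)) (inv (x i)) ⟩
    prod a * (prod B * inv (x i) * prod (invDiff x i))
      ≡⟨ cong (λ z → prod a * (prod B * inv z * prod (invDiff x i))) (sym (+-identityʳ (x i))) ⟩
    prod a * (prod B * inv (x i - 0ℚ) * prod (invDiff x i)) ∎
    where
    B : Vector ℚ t
    B j = b j * x i - b' j
    g : Vector ℚ t
    g j = (a i * b j - a' i * b' j) * invFactor a a' ha ha' hd i j
    regroup : ∀ p q r s → p * q * r * s ≡ p * (q * s * r)
    regroup = solve-∀ ℚ-ring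
    g≡h : ∀ j → j ≢ i → g j ≡ a j * B j * invDiff x i j
    g≡h j j≢i = begin
      (a i * b j - a' i * b' j) * invFactor a a' ha ha' hd i j
        ≡⟨ cong₂ _*_ (a*b-a′*b′≡a′*[b*x-b′] i j) (invFactor-off i j j≢i) ⟩
      a' i * B j * (a j * inv (a' i) * inv (x i - x j))
        ≡⟨ regroup′ (a' i) (inv (a' i)) (a j) (B j) (inv (x i - x j)) ⟩
      a' i * inv (a' i) * (a j * B j * inv (x i - x j))
        ≡⟨ cong₂ _*_ (inv-inverseʳ (ha' i))
                     (cong (a j * B j *_) (sym (invDiff-off x (j≢i ∘ sym)))) ⟩
      1ℚ * (a j * B j * invDiff x i j)
        ≡⟨ *-identityˡ _ ⟩
      a j * B j * invDiff x i j ∎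
      where
      regroup′ : ∀ p ip q r s → p * r * (q * ip * s) ≡ p * ip * (q * r * s)
      regroup′ = solve-∀ ℚ-ring
    gᵢ≡hᵢ*inv[xᵢ] : g i ≡ a i * B i * invDiff x i i * inv (x i)
    gᵢ≡hᵢ*inv[xᵢ] = begin
      (a i * b i - a' i * b' i) * invFactor a a' ha ha' hd i i
        ≡⟨ cong₂ _*_ (a*b-a′*b′≡a′*[b*x-b′] i i) (invFactor-diag i) ⟩
      a' i * B i * 1ℚ
        ≡⟨ sym (*-identityˡ _) ⟩
      1ℚ * (a' i * B i * 1ℚ)
        ≡⟨ cong (_* (a' i * B i * 1ℚ)) (sym (inv-inverseʳ (ha i))) ⟩
      a i * inv (a i) * (a' i * B i * 1ℚ)
        ≡⟨ regroup′ (a i) (inv (a i)) (a' i) (B i) ⟩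
      a i * B i * 1ℚ * (a' i * inv (a i))
        ≡⟨ cong₂ (λ p q → a i * B i * p * q) (sym (invDiff-diag x i)) (sym (inv[x]≡a′*inv[a] i)) ⟩
      a i * B i * invDiff x i i * inv (x i) ∎
      where
      regroup′ : ∀ p ip q r → p * ip * (q * r * 1ℚ) ≡ p * r * 1ℚ * (q * ip)
      regroup′ = solve-∀ ℚ-ring

  a*P[0]*W≡prod[a′*b′] : prod a * (linearProduct b b' 0ℚ * prod (λ j → inv (0ℚ - x j)))
                         ≡ prod (λ i → a' i * b' i)
  a*P[0]*W≡prod[a′*b′] = begin
    prod a * (linearProduct b b' 0ℚ * prod (λ j → inv (0ℚ - x j)))
      ≡⟨ cong (prod a *_) (sym (prod-* (λ k → b k * 0ℚ - b' k) (λ k → inv (0ℚ - x k)))) ⟩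
    prod a * prod (λ k → (b k * 0ℚ - b' k) * inv (0ℚ - x k))
      ≡⟨ sym (prod-* a (λ k → (b k * 0ℚ - b' k) * inv (0ℚ - x k))) ⟩
    prod (λ k → a k * ((b k * 0ℚ - b' k) * inv (0ℚ - x k)))
      ≡⟨ prod-cong factor≡ ⟩
    prod (λ i → a' i * b' i) ∎
    where
    regroup : ∀ p ip q r s → p * ((r * 0ℚ - s) * - (q * ip)) ≡ q * s * (p * ip)
    regroup = solve-∀ ℚ-ring
    factor≡ : ∀ k → a k * ((b k * 0ℚ - b' k) * inv (0ℚ - x k)) ≡ a' k * b' k
    factor≡ k = begin
      a k * ((b k * 0ℚ - b' k) * inv (0ℚ - x k))
        ≡⟨ cong (λ z → a k * ((b k * 0ℚ - b' k) * z)) (inv[0-x]≡-a′*inv[a] k) ⟩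
      a k * ((b k * 0ℚ - b' k) * - (a' k * inv (a k)))
        ≡⟨ regroup (a k) (inv (a k)) (a' k) (b k) (b' k) ⟩
      a' k * b' k * (a k * inv (a k))
        ≡⟨ cong (a' k * b' k *_) (inv-inverseʳ (ha k)) ⟩
      a' k * b' k * 1ℚ
        ≡⟨ *-identityʳ _ ⟩
      a' k * b' k ∎

  interpolation-identity : prod (λ i → a i * b i) - prod (λ i → a' i * b' i)
                         ≡ sum (λ i → prod (λ j → a i * b j - a' i * b' j)
                                      * prod (invFactor a a' ha ha' hd i))
  interpolation-identity = begin
    prod (λ i → a i * b i) - prod (λ i → a' i * b' i)
      ≡⟨ cong₂ _-_ (prod-* a b) (sym a*P[0]*W≡prod[a′*b′]) ⟩
    prod a * prod b - prod a * (P 0ℚ * W₀)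
      ≡⟨ cong (λ p → prod a * p - prod a * (P 0ℚ * W₀))
              (sym (divDiff-linearProduct-leading nodes nodes-injective b b')) ⟩
    prod a * (P 0ℚ * W₀ + divDiff x u) - prod a * (P 0ℚ * W₀)
      ≡⟨ cancel (prod a) (P 0ℚ * W₀) (divDiff x u) ⟩
    prod a * divDiff x u
      ≡⟨ cong (prod a *_) (divDiff≡sum x u) ⟩
    prod a * sum (λ i → u i * prod (invDiff x i))
      ≡⟨ *-distribˡ-sum (prod a) (λ i → u i * prod (invDiff x i)) ⟩
    sum (λ i → prod a * (u i * prod (invDiff x i)))
      ≡⟨ sum-cong (sym ∘ summand≡) ⟩
    sum (λ i → prod (λ j → a i * b j - a' i * b' j) * prod (invFactor a a' ha ha' hd i)) ∎
    where
    P : ℚ → ℚ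
    P = linearProduct b b'
    W₀ : ℚ
    W₀ = prod (λ j → inv (0ℚ - x j))
    -- divDiff nodes (P ∘ nodes) unfolds definitionally to P 0ℚ * W₀ + divDiff x u.
    u : Vector ℚ t
    u i = P (x i) * inv (x i - 0ℚ)
    cancel : ∀ p q r → p * (q + r) - p * q ≡ p * r
    cancel = solve-∀ ℚ-ring

proposition3p7 : (t : ℕ) → 1 ≤ t → (a a' b b' : Fin t → ℚ) →
    (ha : ∀ j → a j ≢ 0ℚ) → (ha' : ∀ j → a' j ≢ 0ℚ) →
    (hd : ∀ i j → i ≢ j → diff a a' ha ha' i j ≢ 0ℚ) →
    prod (λ i → a i * b i) - prod (λ i → a' i * b' i)
      ≡ sum (λ i → prod (λ j → a i * b j - a' i * b' j)
                   * prod (λ j → invFactor a a' ha ha' hd i j))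
proposition3p7 t _ = interpolation-identity
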